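{- Let $G_a$ and $G_b$ be strongly connected permutation digraphs on $n$ vertices and of degree $d$, and let $v_0\in V(G_a)$ and $w_0\in V(G_b)$. Then there exists a color-isomorphism of $G_a$ onto $G_b$ mapping $v_0$ onto $w_0$ if and only if $v_0$ and $w_0$ are indistinguishable.
   Context: For a $d$-tuple $a=(a_1,\dots,a_d)$ of permutations of $[n]=\{1,\dots,n\}$, the permutation digraph $G_a$ has vertex set $[n]$ and arcs $(i,a_k)$, $i\in[n]$, $k\in[d]$; the arc $(i,a_k)$ goes from $i$ to $a_k(i)$ and has color $k$; its degree is $d$. $G_a$ is strongly connected if every vertex is reachable from every other by a directed walk (equivalently, $a$ generates a transitive subgroup of $S_n$). A color-isomorphism of $G_a$ onto $G_b$ is a pair of bijections on vertices and on arcs preserving initial vertices, terminal vertices and colors of arcs. Let $\Sigma=\{k^{+1},k^{ -1}: k\in[d]\}$. For a word $\kappa$ over $\Sigma$ and a vertex $v$ of $G_a$, $W(\kappa,v)$ is the walk in $G_a$ starting at $v$ which, reading $\kappa$ left to right, at a letter $k^{+1}$ traverses the color-$k$ arc from the current vertex $u$ to $a_k(u)$, and at a letter $k^{ -1}$ traverses the color-$k$ arc backwards from $u$ to $a_k^{ -1}(u)$; it is closed if it ends at $v$. A word $\kappa$ is a distinguishing word for $v\in V(G_a)$ and $w\in V(G_b)$ if exactly one of $W(\kappa,v)$ in $G_a$ and $W(\kappa,w)$ in $G_b$ is closed; $v$ and $w$ are distinguishable if such a word exists and indistinguishable otherwise. -}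

module Defs where

open import Data.Nat using (ℕ)
open import Data.Fin using (Fin)
open import Data.Fin.Permutation using (Permutation′; _⟨$⟩ʳ_; _⟨$⟩ˡ_)
open import Data.Product using (_×_; _,_; proj₁; proj₂; Σ; ∃)
open import Data.Sum using (_⊎_)
open import Data.List using (List; []; _∷_)
open import Function.Bundles using (_↔_; Inverse)
open import Relation.Binary.PropositionalEquality using (_≡_)
open import Relation.Nullary using (¬_)

-- A d-tuple of permutations of [n] (vertices [n] are modelled by Fin n,
-- colours [d] by Fin d).
PermTuple : ℕ → ℕ → Set
PermTuple n d = Fin d → Permutation′ n

-- Arcs of G_a: one arc (i, k) for each vertex i and colour k.
Arc : ℕ → ℕ → Set
Arc n d = Fin n × Fin d

module _ {n d : ℕ} (a : PermTuple n d) where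

  initV : Arc n d → Fin n
  initV (i , k) = i

  termV : Arc n d → Fin n
  termV (i , k) = a k ⟨$⟩ʳ i

  colour : Arc n d → Fin d
  colour (i , k) = k

  data Reachable : Fin n → Fin n → Set where
    here : ∀ {u} → Reachable u u
    step : ∀ {u} (k : Fin d) {w} → Reachable (a k ⟨$⟩ʳ u) w → Reachable u w

  StronglyConnected : Set
  StronglyConnected = ∀ u w → Reachable u w

record ColourIso {n d : ℕ} (a b : PermTuple n d) : Set where
  field
    vmap : Fin n ↔ Fin n
    amap : Arc n d ↔ Arc n d
    pres-init : ∀ e → initV b (Inverse.to amap e) ≡ Inverse.to vmap (initV a e)
    pres-term : ∀ e → termV b (Inverse.to amap e) ≡ Inverse.to vmap (termV a e)
    pres-colour : ∀ e → colour b (Inverse.to amap e) ≡ colour a e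

-- Alphabet Σ = { k^{+1}, k^{-1} : k ∈ [d] }
data Sign : Set where
  plus minus : Sign

Letter : ℕ → Set
Letter d = Fin d × Sign

Word : ℕ → Set
Word d = List (Letter d)

stepL : ∀ {n d} → PermTuple n d → Letter d → Fin n → Fin n
stepL a (k , plus)  u = a k ⟨$⟩ʳ u
stepL a (k , minus) u = a k ⟨$⟩ˡ u

-- final vertex of the walk W(κ, v), reading κ left to right
walkEnd : ∀ {n d} → PermTuple n d → Word d → Fin n → Fin n
walkEnd a []      v = v
walkEnd a (x ∷ κ) v = walkEnd a κ (stepL a x v)

ClosedWalk : ∀ {n d} → PermTuple n d → Word d → Fin n → Set
ClosedWalk a κ v = walkEnd a κ v ≡ v

Distinguishing : ∀ {n d} (a b : PermTuple n d) → Word d → Fin n → Fin n → Set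
Distinguishing a b κ v w =
  (ClosedWalk a κ v × ¬ ClosedWalk b κ w) ⊎ (¬ ClosedWalk a κ v × ClosedWalk b κ w)

Indistinguishable : ∀ {n d} (a b : PermTuple n d) → Fin n → Fin n → Set
Indistinguishable a b v w = ¬ (∃ λ κ → Distinguishing a b κ v w)

module Submission where

-- The central notion is a homomorphism of G_a into G_b: a vertex map f with
-- f ∘ a_k = b_k ∘ f for every colour k.  Such a map commutes with every walk
-- (backward steps included), so it carries closed walks at v to closed walks
-- at f v; if it is injective it also reflects them.  The vertex map of a
-- colour-isomorphism is an injective homomorphism, which gives (⇒).
--
-- For (⇐), indistinguishability means closed walks at v₀ and at w₀ are the
-- same words.  Since every vertex u of G_a is the end of some walk W(κ,v₀),
-- putting φ(u) = end of W(κ,w₀) is well defined (two words ending at the same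
-- vertex differ by a closed walk), and φ is a homomorphism with φ v₀ = w₀.
-- The symmetric construction gives ψ : G_b → G_a, and a homomorphism fixing a
-- root of a strongly connected digraph is the identity, so ψ ∘ φ = id and
-- φ ∘ ψ = id.  A bijective homomorphism finally induces a colour-isomorphism.

open import Defs
open import Data.Nat using (ℕ)
open import Data.Fin using (Fin; _≟_)
open import Data.Fin.Permutation using (_⟨$⟩ʳ_; _⟨$⟩ˡ_; inverseˡ; inverseʳ)
open import Data.Product using (Σ; _,_; proj₁; proj₂)
open import Data.Sum using (inj₁; inj₂)
open import Data.List using ([]; _∷_; _++_; [_])
open import Data.Empty using (⊥-elim)
open import Relation.Nullary using (yes; no)
open import Function.Bundles using (Inverse; Injection; _⇔_; mk⇔; mk↔ₛ′)
open import Function.Properties.Inverse using (↔⇒↣)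
open import Relation.Binary.PropositionalEquality
  using (_≡_; refl; sym; trans; cong; subst₂; module ≡-Reasoning)

invertLetter : ∀ {d} → Letter d → Letter d
invertLetter (k , plus)  = k , minus
invertLetter (k , minus) = k , plus

invertWord : ∀ {d} → Word d → Word d
invertWord []      = []
invertWord (x ∷ κ) = invertWord κ ++ [ invertLetter x ]

module Walks {n d : ℕ} (a : PermTuple n d) where

  walkEnd-++ : ∀ κ κ′ v → walkEnd a (κ ++ κ′) v ≡ walkEnd a κ′ (walkEnd a κ v)
  walkEnd-++ []      κ′ v = refl
  walkEnd-++ (x ∷ κ) κ′ v = walkEnd-++ κ κ′ (stepL a x v)

  stepL-invertˡ : ∀ x v → stepL a (invertLetter x) (stepL a x v) ≡ v
  stepL-invertˡ (k , plus)  v = inverseˡ (a k)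
  stepL-invertˡ (k , minus) v = inverseʳ (a k)

  stepL-invertʳ : ∀ x v → stepL a x (stepL a (invertLetter x) v) ≡ v
  stepL-invertʳ (k , plus)  v = inverseʳ (a k)
  stepL-invertʳ (k , minus) v = inverseˡ (a k)

  walkEnd-invertˡ : ∀ κ v → walkEnd a (invertWord κ) (walkEnd a κ v) ≡ v
  walkEnd-invertˡ []      v = refl
  walkEnd-invertˡ (x ∷ κ) v = begin
      walkEnd a (invertWord κ ++ [ invertLetter x ]) (walkEnd a κ (stepL a x v))
        ≡⟨ walkEnd-++ (invertWord κ) _ _ ⟩
      stepL a (invertLetter x) (walkEnd a (invertWord κ) (walkEnd a κ (stepL a x v)))
        ≡⟨ cong (stepL a (invertLetter x)) (walkEnd-invertˡ κ _) ⟩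
      stepL a (invertLetter x) (stepL a x v)
        ≡⟨ stepL-invertˡ x v ⟩
      v ∎
    where open ≡-Reasoning

  walkEnd-invertʳ : ∀ κ v → walkEnd a κ (walkEnd a (invertWord κ) v) ≡ v
  walkEnd-invertʳ []      v = refl
  walkEnd-invertʳ (x ∷ κ) v = begin
      walkEnd a κ (stepL a x (walkEnd a (invertWord κ ++ [ invertLetter x ]) v))
        ≡⟨ cong (λ z → walkEnd a κ (stepL a x z)) (walkEnd-++ (invertWord κ) _ _) ⟩
      walkEnd a κ (stepL a x (stepL a (invertLetter x) (walkEnd a (invertWord κ) v)))
        ≡⟨ cong (walkEnd a κ) (stepL-invertʳ x _) ⟩
      walkEnd a κ (walkEnd a (invertWord κ) v)
        ≡⟨ walkEnd-invertʳ κ v ⟩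
      v ∎
    where open ≡-Reasoning

  reachable⇒word : ∀ {u w} → Reachable a u w → Σ (Word d) (λ κ → walkEnd a κ u ≡ w)
  reachable⇒word here = [] , refl
  reachable⇒word (step k r) with reachable⇒word r
  ... | κ , κ-ends-at-w = (k , plus) ∷ κ , κ-ends-at-w

open Walks

record IsHomomorphism {n d} (a b : PermTuple n d) (f : Fin n → Fin n) : Set where
  constructor homomorphism
  field commutes : ∀ k u → f (a k ⟨$⟩ʳ u) ≡ b k ⟨$⟩ʳ f u

module Homomorphism {n d : ℕ} {a b : PermTuple n d} {f : Fin n → Fin n}
                    (f-hom : IsHomomorphism a b f) where
  open IsHomomorphism f-hom

  hom-backward : ∀ k u → f (a k ⟨$⟩ˡ u) ≡ b k ⟨$⟩ˡ f u
  hom-backward k u = begin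
      f (a k ⟨$⟩ˡ u)
        ≡⟨ sym (inverseˡ (b k)) ⟩
      b k ⟨$⟩ˡ (b k ⟨$⟩ʳ f (a k ⟨$⟩ˡ u))
        ≡⟨ cong (b k ⟨$⟩ˡ_) (sym (commutes k _)) ⟩
      b k ⟨$⟩ˡ f (a k ⟨$⟩ʳ (a k ⟨$⟩ˡ u))
        ≡⟨ cong (λ z → b k ⟨$⟩ˡ f z) (inverseʳ (a k)) ⟩
      b k ⟨$⟩ˡ f u ∎
    where open ≡-Reasoning

  hom-stepL : ∀ x u → f (stepL a x u) ≡ stepL b x (f u)
  hom-stepL (k , plus)  u = commutes k u
  hom-stepL (k , minus) u = hom-backward k u

  hom-walkEnd : ∀ κ u → f (walkEnd a κ u) ≡ walkEnd b κ (f u)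
  hom-walkEnd []      u = refl
  hom-walkEnd (x ∷ κ) u =
    trans (hom-walkEnd κ (stepL a x u)) (cong (walkEnd b κ) (hom-stepL x u))

  hom-indistinguishable : (∀ {u w} → f u ≡ f w → u ≡ w) →
                          ∀ u → Indistinguishable a b u (f u)
  hom-indistinguishable f-inj u (κ , inj₁ (closed , ¬closed)) =
    ¬closed (trans (sym (hom-walkEnd κ u)) (cong f closed))
  hom-indistinguishable f-inj u (κ , inj₂ (¬closed , closed)) =
    ¬closed (f-inj (trans (hom-walkEnd κ u) closed))

-- In a strongly connected digraph an endomorphism fixing one vertex is the
-- identity: every vertex is the end of a walk from that vertex.
endo-fixing-root-is-id : ∀ {n d} {a : PermTuple n d} {f : Fin n → Fin n} →
                         IsHomomorphism a a f → StronglyConnected a →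
                         ∀ v₀ → f v₀ ≡ v₀ → ∀ u → f u ≡ u
endo-fixing-root-is-id {a = a} f-hom sc v₀ fixes u with reachable⇒word a (sc v₀ u)
... | κ , refl = trans (hom-walkEnd κ v₀) (cong (walkEnd a κ) fixes)
  where open Homomorphism f-hom

hom-∘ : ∀ {n d} {a b c : PermTuple n d} {f g : Fin n → Fin n} →
        IsHomomorphism a b f → IsHomomorphism b c g → IsHomomorphism a c (λ u → g (f u))
hom-∘ {f = f} {g} (homomorphism f-hom) (homomorphism g-hom) =
  homomorphism (λ k u → trans (cong g (f-hom k u)) (g-hom k (f u)))

-- The vertex map of a colour-isomorphism is a homomorphism: the image of the
-- arc (u , k) starts at f u, has colour k, and ends at f (a_k u).
colourIso⇒hom : ∀ {n d} {a b : PermTuple n d} (φ : ColourIso a b) →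
                IsHomomorphism a b (Inverse.to (ColourIso.vmap φ))
colourIso⇒hom {a = a} {b} φ = homomorphism arc-image
  where
    open ColourIso φ
    arc-image : ∀ k u → Inverse.to vmap (a k ⟨$⟩ʳ u) ≡ b k ⟨$⟩ʳ Inverse.to vmap u
    arc-image k u =
      sym (subst₂ (λ i k′ → b k′ ⟨$⟩ʳ i ≡ Inverse.to vmap (a k ⟨$⟩ʳ u))
                  (pres-init (u , k)) (pres-colour (u , k)) (pres-term (u , k)))

bijectiveHom⇒colourIso : ∀ {n d} {a b : PermTuple n d} (f g : Fin n → Fin n) →
                         IsHomomorphism a b f →
                         (∀ w → f (g w) ≡ w) → (∀ u → g (f u) ≡ u) →
                         Σ (ColourIso a b) (λ φ → ∀ u → Inverse.to (ColourIso.vmap φ) u ≡ f u)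
bijectiveHom⇒colourIso f g f-hom fg gf = iso , λ _ → refl
  where
    iso : ColourIso _ _
    iso = record
      { vmap        = mk↔ₛ′ f g fg gf
      ; amap        = mk↔ₛ′ (λ { (i , k) → f i , k }) (λ { (i , k) → g i , k })
                            (λ { (i , k) → cong (_, k) (fg i) })
                            (λ { (i , k) → cong (_, k) (gf i) })
      ; pres-init   = λ _ → refl
      ; pres-term   = λ { (i , k) → sym (IsHomomorphism.commutes f-hom k i) }
      ; pres-colour = λ _ → refl
      }

indistinguishable-sym : ∀ {n d} {a b : PermTuple n d} {v w : Fin n} →
                        Indistinguishable a b v w → Indistinguishable b a w v
indistinguishable-sym ind (κ , inj₁ (closed , ¬closed)) = ind (κ , inj₂ (¬closed , closed))
indistinguishable-sym ind (κ , inj₂ (¬closed , closed)) = ind (κ , inj₁ (closed , ¬closed))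

indistinguishable⇒closed : ∀ {n d} {a b : PermTuple n d} {v w : Fin n} →
                           Indistinguishable a b v w →
                           ∀ κ → ClosedWalk a κ v → ClosedWalk b κ w
indistinguishable⇒closed {b = b} {w = w} ind κ closed with walkEnd b κ w ≟ w
... | yes closed′ = closed′
... | no ¬closed′ = ⊥-elim (ind (κ , inj₁ (closed , ¬closed′)))

module WalkTransfer {n d : ℕ} (a b : PermTuple n d) (v₀ w₀ : Fin n)
                    (transfer : ∀ κ → ClosedWalk a κ v₀ → ClosedWalk b κ w₀)
                    (reach : ∀ u → Reachable a v₀ u) where

  -- Two words ending at the same vertex of G_a end at the same vertex of G_b,
  -- since κ followed by the inverse of κ′ is closed at v₀.
  same-end : ∀ κ κ′ → walkEnd a κ v₀ ≡ walkEnd a κ′ v₀ → walkEnd b κ w₀ ≡ walkEnd b κ′ w₀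
  same-end κ κ′ e = begin
      walkEnd b κ w₀
        ≡⟨ sym (walkEnd-invertʳ b κ′ _) ⟩
      walkEnd b κ′ (walkEnd b (invertWord κ′) (walkEnd b κ w₀))
        ≡⟨ cong (walkEnd b κ′) (trans (sym (walkEnd-++ b κ (invertWord κ′) w₀))
                                      (transfer (κ ++ invertWord κ′) closed-in-a)) ⟩
      walkEnd b κ′ w₀ ∎
    where
      open ≡-Reasoning
      closed-in-a : walkEnd a (κ ++ invertWord κ′) v₀ ≡ v₀
      closed-in-a = begin
          walkEnd a (κ ++ invertWord κ′) v₀   ≡⟨ walkEnd-++ a κ (invertWord κ′) v₀ ⟩
          walkEnd a (invertWord κ′) (walkEnd a κ v₀)
                                              ≡⟨ cong (walkEnd a (invertWord κ′)) e ⟩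
          walkEnd a (invertWord κ′) (walkEnd a κ′ v₀)
                                              ≡⟨ walkEnd-invertˡ a κ′ v₀ ⟩
          v₀ ∎

  wordTo : Fin n → Word d
  wordTo u = proj₁ (reachable⇒word a (reach u))

  wordTo-ends : ∀ u → walkEnd a (wordTo u) v₀ ≡ u
  wordTo-ends u = proj₂ (reachable⇒word a (reach u))

  φ : Fin n → Fin n
  φ u = walkEnd b (wordTo u) w₀

  φ-walkEnd : ∀ κ → φ (walkEnd a κ v₀) ≡ walkEnd b κ w₀
  φ-walkEnd κ = same-end (wordTo (walkEnd a κ v₀)) κ (wordTo-ends _)

  φ-root : φ v₀ ≡ w₀
  φ-root = φ-walkEnd []

  φ-commutes : ∀ k u → φ (a k ⟨$⟩ʳ u) ≡ b k ⟨$⟩ʳ φ u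
  φ-commutes k u = begin
      φ (a k ⟨$⟩ʳ u)
        ≡⟨ cong (λ z → φ (a k ⟨$⟩ʳ z)) (sym (wordTo-ends u)) ⟩
      φ (a k ⟨$⟩ʳ walkEnd a (wordTo u) v₀)
        ≡⟨ cong φ (sym (walkEnd-++ a (wordTo u) [ k , plus ] v₀)) ⟩
      φ (walkEnd a (wordTo u ++ [ k , plus ]) v₀)
        ≡⟨ φ-walkEnd (wordTo u ++ [ k , plus ]) ⟩
      walkEnd b (wordTo u ++ [ k , plus ]) w₀
        ≡⟨ walkEnd-++ b (wordTo u) _ w₀ ⟩
      b k ⟨$⟩ʳ φ u ∎
    where open ≡-Reasoning

  φ-hom : IsHomomorphism a b φ
  φ-hom = homomorphism φ-commutes

indistinguishable⇒colourIso :
  ∀ {n d} (a b : PermTuple n d) → StronglyConnected a → StronglyConnected b →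
  ∀ v₀ w₀ → Indistinguishable a b v₀ w₀ →
  Σ (ColourIso a b) (λ φ → Inverse.to (ColourIso.vmap φ) v₀ ≡ w₀)
indistinguishable⇒colourIso a b sca scb v₀ w₀ ind =
  proj₁ iso , trans (proj₂ iso v₀) A.φ-root
  where
    module A = WalkTransfer a b v₀ w₀ (indistinguishable⇒closed ind) (sca v₀)
    module B = WalkTransfer b a w₀ v₀
                 (indistinguishable⇒closed (indistinguishable-sym ind)) (scb w₀)
    ψφ≡id : ∀ u → B.φ (A.φ u) ≡ u
    ψφ≡id = endo-fixing-root-is-id (hom-∘ A.φ-hom B.φ-hom) sca v₀
              (trans (cong B.φ A.φ-root) B.φ-root)
    φψ≡id : ∀ w → A.φ (B.φ w) ≡ w
    φψ≡id = endo-fixing-root-is-id (hom-∘ B.φ-hom A.φ-hom) scb w₀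
              (trans (cong A.φ B.φ-root) A.φ-root)
    iso = bijectiveHom⇒colourIso A.φ B.φ A.φ-hom φψ≡id ψφ≡id

colourIso⇒indistinguishable : ∀ {n d} {a b : PermTuple n d} (φ : ColourIso a b) →
                              ∀ v → Indistinguishable a b v (Inverse.to (ColourIso.vmap φ) v)
colourIso⇒indistinguishable φ =
  Homomorphism.hom-indistinguishable (colourIso⇒hom φ) (Injection.injective (↔⇒↣ (ColourIso.vmap φ)))

theorem4 : ∀ {n d : ℕ} (a b : PermTuple n d) →
    StronglyConnected a → StronglyConnected b →
    (v₀ w₀ : Fin n) →
    (Σ (ColourIso a b) (λ φ → Inverse.to (ColourIso.vmap φ) v₀ ≡ w₀))
      ⇔ Indistinguishable a b v₀ w₀
theorem4 a b sca scb v₀ w₀ =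
  mk⇔ (λ { (φ , refl) → colourIso⇒indistinguishable φ v₀ })
      (indistinguishable⇒colourIso a b sca scb v₀ w₀)
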